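{- Let $M_1,\dots,M_d$ be matroids on the same finite ground set $E$ and let $k\ge 1$ be an integer. If $E$ has a $2k$-covering by sets $V_1,\dots,V_d$ with $V_i$ independent in $M_i$ for every $i$, then Alice has a winning strategy in the matroid $k$-coloring game on $M_1,\dots,M_d$. In particular, every loopless matroid $M$ satisfies $\chi_g(M)\le 2\chi(M)$ and $\chi_{f,g}(M)\le 2\chi_f(M)$.
   Context: A collection of (not necessarily distinct) subsets $V_1,\dots,V_d\subseteq E$ is a $k$-covering of $E$ if every $e\in E$ belongs to exactly $k$ members of the collection. The $k$-coloring game on $M_1,\dots,M_d$: the set of colors is $\{1,\dots,d\}$; Alice and Bob alternately make moves, Alice first; a move consists of choosing an element $e\in E$ that currently has fewer than $k$ colors and a color $i$ not yet assigned to $e$, and assigning $i$ to $e$, subject to the rule that for every $i$ the set of elements having color $i$ must always be independent in $M_i$. Alice wins if every element ends up with exactly $k$ colors; Bob wins if the play reaches a position where no admissible move exists while some element has fewer than $k$ colors. For a loopless matroid $M$: $\chi(M)$ is the minimum number of independent sets needed to partition (equivalently $1$-cover) its ground set; $\chi_f(M)$ is the infimum of $b/a$ over integers $a,b$ such that $M$ has an $a$-covering by $b$ independent sets; $\chi_g(M)$ is the minimum number $d$ of colors such that Alice has a winning strategy in the $1$-coloring game on $M_1=\dots=M_d=M$; $\chi_{f,g}(M)$ is the infimum of $b/a$ over integers $a,b$ such that Alice has a winning strategy in the $a$-coloring game on $M_1=\dots=M_b=M$. -}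

module Defs where

open import Data.Nat using (ℕ; _<_; _≤_; _*_)
open import Data.Fin using (Fin; _≟_)
open import Relation.Nullary using (yes; no)
open import Data.Fin.Subset using (Subset; _∈_; _∉_; _⊆_; _∪_; ⁅_⁆; ∣_∣) renaming (⊥ to ∅)
open import Data.Vec using (tabulate; lookup)
open import Data.Product using (Σ; ∃; _×_; _,_)
open import Data.Sum using (_⊎_)
open import Relation.Binary.PropositionalEquality using (_≡_)

record Matroid (n : ℕ) : Set₁ where
  field
    Indep        : Subset n → Set
    indep-∅      : Indep ∅
    indep-⊆      : ∀ {A B} → A ⊆ B → Indep B → Indep A
    indep-augment : ∀ {A B} → Indep A → Indep B → ∣ A ∣ < ∣ B ∣ →
                    ∃ λ x → x ∈ B × x ∉ A × Indep (A ∪ ⁅ x ⁆)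
open Matroid public

Loopless : ∀ {n} → Matroid n → Set
Loopless {n} M = (e : Fin n) → Indep M ⁅ e ⁆

membersOf : ∀ {n d} → (Fin d → Subset n) → Fin n → Subset d
membersOf V e = tabulate (λ i → lookup (V i) e)

mult : ∀ {n d} → (Fin d → Subset n) → Fin n → ℕ
mult V e = ∣ membersOf V e ∣

IsCovering : ∀ {n d} → ℕ → (Fin d → Subset n) → Set
IsCovering {n} k V = (e : Fin n) → mult V e ≡ k

AllIndep : ∀ {n d} → (Fin d → Matroid n) → (Fin d → Subset n) → Set
AllIndep M V = ∀ i → Indep (M i) (V i)

Position : ℕ → ℕ → Set
Position n d = Fin d → Subset n

start : ∀ {n d} → Position n d
start _ = ∅

ncolours : ∀ {n d} → Position n d → Fin n → ℕ
ncolours P e = mult P e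

Complete : ∀ {n d} → ℕ → Position n d → Set
Complete k P = IsCovering k P

assign : ∀ {n d} → Position n d → Fin n → Fin d → Position n d
assign P e i j with i ≟ j
... | yes _ = P j ∪ ⁅ e ⁆
... | no  _ = P j

Admissible : ∀ {n d} → (Fin d → Matroid n) → ℕ → Position n d → Fin n → Fin d → Set
Admissible M k P e i = ncolours P e < k × e ∉ P i × Indep (M i) (P i ∪ ⁅ e ⁆)

-- The game is finite (each move adds a
-- colour), so these inductive predicates express existence of a winning strategy.
mutual
  data AliceToMove {n d} (M : Fin d → Matroid n) (k : ℕ) (P : Position n d) : Set where
    done  : Complete k P → AliceToMove M k P
    play  : (e : Fin n) (i : Fin d) → Admissible M k P e i →
            BobToMove M k (assign P e i) → AliceToMove M k P

  data BobToMove {n d} (M : Fin d → Matroid n) (k : ℕ) (P : Position n d) : Set where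
    done  : Complete k P → BobToMove M k P
    reply : (Σ (Fin n) λ e → Σ (Fin d) λ i → Admissible M k P e i) →
            ((e : Fin n) (i : Fin d) → Admissible M k P e i →
              AliceToMove M k (assign P e i)) → BobToMove M k P

AliceWins : ∀ {n d} → (Fin d → Matroid n) → ℕ → Set
AliceWins M k = AliceToMove M k start

-- Alice uses the 2k-covering V as a reservation W, with W i independent in M i, and
-- maintains: every colour class P i lies inside W i, no element has more than k colours,
-- and every element is balanced, i.e. the number of reserved classes containing it plus
-- the number of its colours is at least 2k.  When Bob gives e the colour i, the
-- augmentation axiom extends P i ∪ {e} to an independent set containing all of W i but
-- at most one element f; making it the new W i costs one unit of balance, and only at f.
-- Alice then colours f if it lacks colours, and otherwise any element that does: such an
-- element, balanced up to one unit, lies in more reserved classes than it has colours, so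
-- some reserved colour is free for it; that colour keeps its class independent and
-- restores the balance.  Hence a move is available as long as some element is not
-- k-coloured, and as every move colours a new pair the game ends in Alice's favour.
-- Doubling a covering gives the bounds on the game chromatic numbers.
module Submission where

open import Data.Fin using (Fin; zero; suc; _≟_; splitAt)
open import Data.Fin.Properties using (any?)
open import Data.Fin.Subset using (Subset; _∈_; _∉_; _⊆_; _∪_; ⁅_⁆; ∣_∣; inside; outside)
  renaming (⊥ to ∅)
open import Data.Fin.Subset.Properties
  using (_∈?_; ∉⊥; ⊥⊆; ⊆-refl; ⊆-trans; x∈⁅x⁆; x∈⁅y⁆⇒x≡y; ∣⁅x⁆∣≡1; ∣⊥∣≡0; ∣p∣≤n; ∣p∣≤∣x∷p∣;
         p⊆p∪q; q⊆p∪q; x∈p∪q⁻; x∈p∪q⁺; p⊆q⇒∣p∣≤∣q∣; p⊂q⇒∣p∣<∣q∣)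
open import Data.Nat using (ℕ; zero; suc; _+_; _*_; _∸_; _≤_; _<_; z≤n; s≤s)
open import Data.Nat.Properties hiding (_≟_)
open import Algebra.Properties.Monoid.Sum +-0-monoid using (sum)
open import Data.Nat.Solver using (module +-*-Solver)
open import Data.Product using (Σ; ∃; ∃₂; _×_; _,_)
open import Data.Sum using (_⊎_; inj₁; inj₂; [_,_]; [_,_]′)
open import Data.Sum.Properties using ([,]-∘; [,]-cong)
open import Data.Vec as Vec using ([]; _∷_; tabulate; lookup)
open import Data.Vec.Properties using (lookup∘tabulate; lookup⇒[]=; []=⇒lookup; tabulate∘lookup; tabulate-cong; lookup-splitAt)
open import Data.Vec.Functional using (_++_; updateAt)
open import Data.Vec.Functional.Properties using (updateAt-updates; updateAt-minimal)
open import Function using (_∘_)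
open import Relation.Nullary using (yes; no)
open import Relation.Nullary.Decidable using (_×-dec_; ¬?; decidable-stable)
open import Relation.Nullary.Negation using (contradiction)
open import Relation.Binary.PropositionalEquality
  using (_≡_; _≢_; refl; sym; trans; cong; cong₂; subst; module ≡-Reasoning)

open import Defs

∪-least : ∀ {n} {p q r : Subset n} → p ⊆ r → q ⊆ r → p ∪ q ⊆ r
∪-least {p = p} {q} p⊆r q⊆r x∈p∪q = [ p⊆r , q⊆r ] (x∈p∪q⁻ p q x∈p∪q)

x∈p⇒⁅x⁆⊆p : ∀ {n} {x : Fin n} {p} → x ∈ p → ⁅ x ⁆ ⊆ p
x∈p⇒⁅x⁆⊆p {x = x} {p} x∈p y∈⁅x⁆ = subst (_∈ p) (sym (x∈⁅y⁆⇒x≡y x y∈⁅x⁆)) x∈p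

x∈p∪⁅y⁆∧x≢y⇒x∈p : ∀ {n} {x y : Fin n} {p} → x ∈ p ∪ ⁅ y ⁆ → x ≢ y → x ∈ p
x∈p∪⁅y⁆∧x≢y⇒x∈p {y = y} {p} x∈ x≢y with x∈p∪q⁻ p ⁅ y ⁆ x∈
... | inj₁ x∈p    = x∈p
... | inj₂ x∈⁅y⁆ = contradiction (x∈⁅y⁆⇒x≡y y x∈⁅y⁆) x≢y

∣p∪q∣≤∣p∣+∣q∣ : ∀ {n} (p q : Subset n) → ∣ p ∪ q ∣ ≤ ∣ p ∣ + ∣ q ∣
∣p∪q∣≤∣p∣+∣q∣ []            []            = z≤n
∣p∪q∣≤∣p∣+∣q∣ (inside  ∷ p) (y       ∷ q) = s≤s (≤-trans (∣p∪q∣≤∣p∣+∣q∣ p q) (+-monoʳ-≤ ∣ p ∣ (∣p∣≤∣x∷p∣ y q)))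
∣p∪q∣≤∣p∣+∣q∣ (outside ∷ p) (inside  ∷ q) = ≤-trans (s≤s (∣p∪q∣≤∣p∣+∣q∣ p q)) (≤-reflexive (sym (+-suc ∣ p ∣ ∣ q ∣)))
∣p∪q∣≤∣p∣+∣q∣ (outside ∷ p) (outside ∷ q) = ∣p∪q∣≤∣p∣+∣q∣ p q

∣p++q∣≡∣p∣+∣q∣ : ∀ {m n} (p : Subset m) (q : Subset n) → ∣ p Vec.++ q ∣ ≡ ∣ p ∣ + ∣ q ∣
∣p++q∣≡∣p∣+∣q∣ []            q = refl
∣p++q∣≡∣p∣+∣q∣ (inside  ∷ p) q = cong suc (∣p++q∣≡∣p∣+∣q∣ p q)
∣p++q∣≡∣p∣+∣q∣ (outside ∷ p) q = ∣p++q∣≡∣p∣+∣q∣ p q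

p⊆q∪⁅x⁆⇒∣p∣≤1+∣q∣ : ∀ {n} {p q : Subset n} {x} → p ⊆ q ∪ ⁅ x ⁆ → ∣ p ∣ ≤ suc ∣ q ∣
p⊆q∪⁅x⁆⇒∣p∣≤1+∣q∣ {p = p} {q} {x} p⊆ = begin
  ∣ p ∣ ≤⟨ p⊆q⇒∣p∣≤∣q∣ p⊆ ⟩
  ∣ q ∪ ⁅ x ⁆ ∣ ≤⟨ ∣p∪q∣≤∣p∣+∣q∣ q ⁅ x ⁆ ⟩
  ∣ q ∣ + ∣ ⁅ x ⁆ ∣ ≡⟨ cong (∣ q ∣ +_) (∣⁅x⁆∣≡1 x) ⟩
  ∣ q ∣ + 1 ≡⟨ +-comm ∣ q ∣ 1 ⟩
  suc ∣ q ∣ ∎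
  where open ≤-Reasoning

∣p∣<∣p∪⁅x⁆∣ : ∀ {n} {p : Subset n} {x} → x ∉ p → ∣ p ∣ < ∣ p ∪ ⁅ x ⁆ ∣
∣p∣<∣p∪⁅x⁆∣ {x = x} x∉p = p⊂q⇒∣p∣<∣q∣ (p⊆p∪q _ , x , x∈p∪q⁺ (inj₂ (x∈⁅x⁆ x)) , x∉p)

∣p∣<∣q∣⇒∃∈q∉p : ∀ {n} {p q : Subset n} → ∣ p ∣ < ∣ q ∣ → ∃ λ x → x ∈ q × x ∉ p
∣p∣<∣q∣⇒∃∈q∉p {p = p} {q} ∣p∣<∣q∣ with any? (λ x → x ∈? q ×-dec ¬? (x ∈? p))
... | yes witness = witness
... | no none = contradiction (p⊆q⇒∣p∣≤∣q∣ q⊆p) (<⇒≱ ∣p∣<∣q∣)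
  where
    q⊆p : q ⊆ p
    q⊆p {x} x∈q = decidable-stable (x ∈? p) (λ x∉p → none (x , x∈q , x∉p))

p⊆q∪⁅x⁆⇒∃[f]q-f⊆p : ∀ {n} {p q : Subset n} (x : Fin n) → p ⊆ q ∪ ⁅ x ⁆ → ∣ q ∣ ≤ ∣ p ∣ →
                     ∃ λ f → ∀ {g} → g ≢ f → g ∈ q → g ∈ p
p⊆q∪⁅x⁆⇒∃[f]q-f⊆p {p = p} {q} x p⊆ ∣q∣≤∣p∣ with any? (λ f → f ∈? q ×-dec ¬? (f ∈? p))
... | no none = x , λ {g} _ g∈q → decidable-stable (g ∈? p) (λ g∉p → none (g , g∈q , g∉p))
... | yes (f , f∈q , f∉p) = f , λ {g} g≢f g∈q → decidable-stable (g ∈? p) (λ g∉p → <-irrefl refl (too-large g≢f g∈q g∉p))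
  where
    too-large : ∀ {g} → g ≢ f → g ∈ q → g ∉ p → suc ∣ q ∣ < suc ∣ q ∣
    too-large {g} g≢f g∈q g∉p = begin-strict
      suc ∣ q ∣                 ≤⟨ s≤s ∣q∣≤∣p∣ ⟩
      suc ∣ p ∣                 ≤⟨ ∣p∣<∣p∪⁅x⁆∣ f∉p ⟩
      ∣ p ∪ ⁅ f ⁆ ∣             <⟨ ∣p∣<∣p∪⁅x⁆∣ g∉p∪⁅f⁆ ⟩
      ∣ (p ∪ ⁅ f ⁆) ∪ ⁅ g ⁆ ∣ ≤⟨ p⊆q∪⁅x⁆⇒∣p∣≤1+∣q∣ p∪f∪g⊆ ⟩
      suc ∣ q ∣                 ∎
      where
        open ≤-Reasoning
        g∉p∪⁅f⁆ : g ∉ p ∪ ⁅ f ⁆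
        g∉p∪⁅f⁆ g∈ = g∉p (x∈p∪⁅y⁆∧x≢y⇒x∈p g∈ g≢f)
        p∪f∪g⊆ : (p ∪ ⁅ f ⁆) ∪ ⁅ g ⁆ ⊆ q ∪ ⁅ x ⁆
        p∪f∪g⊆ = ∪-least (∪-least p⊆ (x∈p⇒⁅x⁆⊆p (p⊆p∪q _ f∈q))) (x∈p⇒⁅x⁆⊆p (p⊆p∪q _ g∈q))

module _ {n : ℕ} (M : Matroid n) where

  independent-extension : ∀ {A B} → Indep M A → Indep M B →
                          ∃ λ C → A ⊆ C × C ⊆ A ∪ B × Indep M C × ∣ B ∣ ≤ ∣ C ∣
  independent-extension {A} {B} iA iB = extend ∣ B ∣ (m≤m+n ∣ B ∣ ∣ A ∣) iA
    where
      extend : ∀ m {A} → ∣ B ∣ ≤ m + ∣ A ∣ → Indep M A →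
               ∃ λ C → A ⊆ C × C ⊆ A ∪ B × Indep M C × ∣ B ∣ ≤ ∣ C ∣
      extend m {A} ∣B∣≤ iA with ∣ B ∣ ≤? ∣ A ∣
      ... | yes ∣B∣≤∣A∣ = A , ⊆-refl , p⊆p∪q B , iA , ∣B∣≤∣A∣
      extend zero          ∣B∣≤ iA | no ∣B∣≰∣A∣ = contradiction ∣B∣≤ ∣B∣≰∣A∣
      extend (suc m) {A} ∣B∣≤ iA | no ∣B∣≰∣A∣ with indep-augment M iA iB (≰⇒> ∣B∣≰∣A∣)
      ... | x , x∈B , x∉A , iA+x =
        let C , A+x⊆C , C⊆ , iC , ∣B∣≤∣C∣ = extend m ∣B∣≤′ iA+x
        in  C , ⊆-trans (p⊆p∪q _) A+x⊆C , ⊆-trans C⊆ A+x∪B⊆A∪B , iC , ∣B∣≤∣C∣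
        where
          ∣B∣≤′ : ∣ B ∣ ≤ m + ∣ A ∪ ⁅ x ⁆ ∣
          ∣B∣≤′ = ≤-trans ∣B∣≤ (≤-trans (≤-reflexive (sym (+-suc m ∣ A ∣))) (+-monoʳ-≤ m (∣p∣<∣p∪⁅x⁆∣ x∉A)))
          A+x∪B⊆A∪B : (A ∪ ⁅ x ⁆) ∪ B ⊆ A ∪ B
          A+x∪B⊆A∪B = ∪-least (∪-least (p⊆p∪q B) (x∈p⇒⁅x⁆⊆p (q⊆p∪q A B x∈B))) (q⊆p∪q A B)

  exchange : ∀ {W P e} → Indep M W → P ⊆ W → Indep M (P ∪ ⁅ e ⁆) →
             ∃ λ A → Indep M A × P ∪ ⁅ e ⁆ ⊆ A × ∃ λ f → ∀ {g} → g ≢ f → g ∈ W → g ∈ A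
  exchange {W} {P} {e} iW P⊆W iP+e with independent-extension iP+e iW
  ... | A , P+e⊆A , A⊆ , iA , ∣W∣≤∣A∣ =
    A , iA , P+e⊆A , p⊆q∪⁅x⁆⇒∃[f]q-f⊆p e (⊆-trans A⊆ P+e∪W⊆W+e) ∣W∣≤∣A∣
    where
      P+e∪W⊆W+e : (P ∪ ⁅ e ⁆) ∪ W ⊆ W ∪ ⁅ e ⁆
      P+e∪W⊆W+e = ∪-least (∪-least (⊆-trans P⊆W (p⊆p∪q _)) (q⊆p∪q W _)) (p⊆p∪q _)

module _ {n d : ℕ} {g : Fin n} where

  ∈-membersOf⁺ : ∀ (V : Fin d → Subset n) {j} → g ∈ V j → j ∈ membersOf V g
  ∈-membersOf⁺ V {j} g∈Vj = lookup⇒[]= j _ (trans (lookup∘tabulate (λ i → lookup (V i) g) j) ([]=⇒lookup g∈Vj))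

  ∈-membersOf⁻ : ∀ (V : Fin d → Subset n) {j} → j ∈ membersOf V g → g ∈ V j
  ∈-membersOf⁻ V {j} j∈ = lookup⇒[]= g (V j) (trans (sym (lookup∘tabulate (λ i → lookup (V i) g) j)) ([]=⇒lookup j∈))

  mult-mono : ∀ {V V′ : Fin d → Subset n} → (∀ j → g ∈ V j → g ∈ V′ j) → mult V g ≤ mult V′ g
  mult-mono {V} {V′} V⊆V′ = p⊆q⇒∣p∣≤∣q∣ λ {j} j∈ → ∈-membersOf⁺ V′ (V⊆V′ j (∈-membersOf⁻ V j∈))

  mult-mono-< : ∀ {V V′ : Fin d → Subset n} → (∀ j → g ∈ V j → g ∈ V′ j) →
                ∀ {i} → g ∈ V′ i → g ∉ V i → mult V g < mult V′ g
  mult-mono-< {V} {V′} V⊆V′ {i} g∈V′i g∉Vi = p⊂q⇒∣p∣<∣q∣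
    ( (λ {j} j∈ → ∈-membersOf⁺ V′ (V⊆V′ j (∈-membersOf⁻ V j∈)))
    , i , ∈-membersOf⁺ V′ g∈V′i , g∉Vi ∘ ∈-membersOf⁻ V )

  mult≤1+mult : ∀ {V V′ : Fin d → Subset n} i → (∀ j → j ≢ i → g ∈ V j → g ∈ V′ j) → mult V g ≤ suc (mult V′ g)
  mult≤1+mult {V} {V′} i V⊆V′ = p⊆q∪⁅x⁆⇒∣p∣≤1+∣q∣ members⊆
    where
      members⊆ : membersOf V g ⊆ membersOf V′ g ∪ ⁅ i ⁆
      members⊆ {j} j∈ with j ≟ i
      ... | yes refl = x∈p∪q⁺ (inj₂ (x∈⁅x⁆ j))
      ... | no j≢i   = x∈p∪q⁺ (inj₁ (∈-membersOf⁺ V′ (V⊆V′ j j≢i (∈-membersOf⁻ V j∈))))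

  mult<mult⇒∃ : ∀ {V V′ : Fin d → Subset n} → mult V g < mult V′ g → ∃ λ j → g ∈ V′ j × g ∉ V j
  mult<mult⇒∃ {V} {V′} lt with ∣p∣<∣q∣⇒∃∈q∉p lt
  ... | j , j∈′ , j∉ = j , ∈-membersOf⁻ V′ j∈′ , j∉ ∘ ∈-membersOf⁺ V

ncolours-start : ∀ {n d} (g : Fin n) → ncolours (start {n} {d}) g ≡ 0
ncolours-start {n} {d} g = n≤0⇒n≡0 (≤-trans (p⊆q⇒∣p∣≤∣q∣ no-colours) (≤-reflexive (∣⊥∣≡0 d)))
  where
    no-colours : membersOf (start {n} {d}) g ⊆ ∅
    no-colours j∈ = contradiction (∈-membersOf⁻ {g = g} start j∈) ∉⊥

membersOf-++ : ∀ {n d d′} (V : Fin d → Subset n) (V′ : Fin d′ → Subset n) g →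
               membersOf (V ++ V′) g ≡ membersOf V g Vec.++ membersOf V′ g
membersOf-++ {d = d} V V′ g = begin
  tabulate (λ j → lookup ((V ++ V′) j) g)    ≡⟨ tabulate-cong lookup-++ ⟩
  tabulate (lookup (mV Vec.++ mV′))          ≡⟨ tabulate∘lookup (mV Vec.++ mV′) ⟩
  mV Vec.++ mV′                              ∎
  where
    open ≡-Reasoning
    mV  = membersOf V g
    mV′ = membersOf V′ g
    lookup-++ : ∀ j → lookup ((V ++ V′) j) g ≡ lookup (mV Vec.++ mV′) j
    lookup-++ j = begin
      lookup ([ V , V′ ]′ (splitAt d j)) g                                ≡⟨ [,]-∘ (λ S → lookup S g) (splitAt d j) ⟩
      [ (λ i → lookup (V i) g) , (λ i → lookup (V′ i) g) ]′ (splitAt d j) ≡⟨ [,]-cong (sym ∘ lookup∘tabulate _) (sym ∘ lookup∘tabulate _) (splitAt d j) ⟩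
      [ lookup mV , lookup mV′ ]′ (splitAt d j)                           ≡⟨ lookup-splitAt d mV mV′ j ⟨
      lookup (mV Vec.++ mV′) j                                            ∎

mult-++ : ∀ {n d d′} (V : Fin d → Subset n) (V′ : Fin d′ → Subset n) g → mult (V ++ V′) g ≡ mult V g + mult V′ g
mult-++ V V′ g = trans (cong ∣_∣ (membersOf-++ V V′ g)) (∣p++q∣≡∣p∣+∣q∣ (membersOf V g) (membersOf V′ g))

updateAt-satisfies : ∀ {d} {A : Set} (Q : Fin d → A → Set) (xs : Fin d → A) i (f : A → A) →
                     Q i (f (xs i)) → (∀ j → j ≢ i → Q j (xs j)) → ∀ j → Q j (updateAt xs i f j)
updateAt-satisfies Q xs i f Qi Qj j with j ≟ i
... | yes refl = subst (Q i) (sym (updateAt-updates i xs)) Qi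
... | no j≢i   = subst (Q j) (sym (updateAt-minimal j i xs j≢i)) (Qj j j≢i)

module _ {n d : ℕ} where

  assign-satisfies : ∀ (Q : Fin d → Subset n → Set) (P : Position n d) e i →
                     Q i (P i ∪ ⁅ e ⁆) → (∀ j → i ≢ j → Q j (P j)) → ∀ j → Q j (assign P e i j)
  assign-satisfies Q P e i Qi Qj j with i ≟ j
  ... | yes refl = Qi
  ... | no i≢j   = Qj j i≢j

  module _ (P : Position n d) (e : Fin n) (i : Fin d) where

    ⊆-assign : ∀ j → P j ⊆ assign P e i j
    ⊆-assign = assign-satisfies (λ j S → P j ⊆ S) P e i (p⊆p∪q _) (λ _ _ → ⊆-refl)

    assign-⊆ : ∀ {Q : Position n d} → P i ∪ ⁅ e ⁆ ⊆ Q i → (∀ j → P j ⊆ Q j) → ∀ j → assign P e i j ⊆ Q j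
    assign-⊆ {Q} P+e⊆Qi P⊆Q = assign-satisfies (λ j S → S ⊆ Q j) P e i P+e⊆Qi (λ j _ → P⊆Q j)

    e∈assign : e ∈ assign P e i i
    e∈assign with i ≟ i
    ... | yes _   = x∈p∪q⁺ (inj₂ (x∈⁅x⁆ e))
    ... | no i≢i = contradiction refl i≢i

    ncolours-assign-≥ : ∀ g → ncolours P g ≤ ncolours (assign P e i) g
    ncolours-assign-≥ g = mult-mono {V = P} {assign P e i} (λ j → ⊆-assign j)

    ncolours-assign-> : e ∉ P i → ncolours P e < ncolours (assign P e i) e
    ncolours-assign-> e∉Pi = mult-mono-< {V = P} {assign P e i} (λ j → ⊆-assign j) e∈assign e∉Pi

    ncolours-assign-≤ : ∀ g → ncolours (assign P e i) g ≤ suc (ncolours P g)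
    ncolours-assign-≤ g = mult≤1+mult {V = assign P e i} {P} i λ j j≢i →
      assign-satisfies (λ j S → i ≢ j → S ⊆ P j) P e i (λ i≢i → contradiction refl i≢i) (λ _ _ _ → ⊆-refl) j (j≢i ∘ sym)

    ncolours-assign-≢ : ∀ {g} → g ≢ e → ncolours (assign P e i) g ≤ ncolours P g
    ncolours-assign-≢ g≢e = mult-mono {V = assign P e i} {P} λ j g∈ →
      x∈p∪⁅y⁆∧x≢y⇒x∈p (assign-satisfies (λ j S → S ⊆ P j ∪ ⁅ e ⁆) P e i ⊆-refl (λ _ _ → p⊆p∪q _) j g∈) g≢e

sum-mono-≤ : ∀ {m} {f g : Fin m → ℕ} → (∀ i → f i ≤ g i) → sum f ≤ sum g
sum-mono-≤ {zero}  f≤g = z≤n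
sum-mono-≤ {suc m} f≤g = +-mono-≤ (f≤g zero) (sum-mono-≤ (f≤g ∘ suc))

sum-mono-< : ∀ {m} {f g : Fin m → ℕ} → (∀ i → f i ≤ g i) → ∀ i → f i < g i → sum f < sum g
sum-mono-< {suc m} f≤g zero    f0<g0 = +-mono-<-≤ f0<g0 (sum-mono-≤ (f≤g ∘ suc))
sum-mono-< {suc m} f≤g (suc i) fi<gi = +-mono-≤-< (f≤g zero) (sum-mono-< (f≤g ∘ suc) i fi<gi)

uncoloured : ∀ {n d} → Position n d → ℕ
uncoloured {n} P = sum (λ i → n ∸ ∣ P i ∣)

uncoloured-assign : ∀ {n d} (P : Position n d) e i → e ∉ P i → uncoloured (assign P e i) < uncoloured P
uncoloured-assign {n} P e i e∉Pi = sum-mono-<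
  (λ j → ∸-monoʳ-≤ n (p⊆q⇒∣p∣≤∣q∣ (⊆-assign P e i j)))
  i (∸-monoʳ-< (p⊂q⇒∣p∣<∣q∣ (⊆-assign P e i i , e , e∈assign P e i , e∉Pi)) (∣p∣≤n (assign P e i i)))

k+k≤1+w+c∧c<k⇒c<w : ∀ {k w c} → k + k ≤ suc (w + c) → c < k → c < w
k+k≤1+w+c∧c<k⇒c<w {k} {w} {c} k+k≤ c<k = +-cancelʳ-≤ c (suc c) w (≤-pred (begin
  suc (suc c + c) ≡⟨ +-suc (suc c) c ⟨
  suc c + suc c   ≤⟨ +-mono-≤ c<k c<k ⟩
  k + k           ≤⟨ k+k≤ ⟩
  suc (w + c)     ∎))
  where open ≤-Reasoning

complete-or-deficient : ∀ {n d} (P : Position n d) k → (∀ g → ncolours P g ≤ k) →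
                        Complete k P ⊎ ∃ λ e → ncolours P e < k
complete-or-deficient P k bounded with any? (λ e → ncolours P e <? k)
... | yes deficient = inj₂ deficient
... | no none = inj₁ λ e → ≤-antisym (bounded e) (≮⇒≥ λ e<k → none (e , e<k))

module Strategy {n d : ℕ} (M : Fin d → Matroid n) (k : ℕ) where

  Balanced : Position n d → Position n d → Fin n → Set
  Balanced P W g = k + k ≤ mult W g + ncolours P g

  record Reservation (P W : Position n d) : Set where
    field
      independent : AllIndep M W
      extends     : ∀ i → P i ⊆ W i
      bounded     : ∀ g → ncolours P g ≤ k

  record Safe (P W : Position n d) : Set where
    field
      reservation : Reservation P W
      balanced    : ∀ g → Balanced P W g

  record SafeExcept (P W : Position n d) (f : Fin n) : Set where
    field
      reservation : Reservation P W
      balanced    : ∀ g → g ≢ f → Balanced P W g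
      nearly      : k + k ≤ suc (mult W f + ncolours P f)

  open Reservation

  safe⇒safeExcept : ∀ {P W} → Safe P W → ∀ f → SafeExcept P W f
  safe⇒safeExcept I f = record
    { reservation = Safe.reservation I
    ; balanced    = λ g _ → Safe.balanced I g
    ; nearly      = m≤n⇒m≤1+n (Safe.balanced I f)
    }

  safeExcept⇒safe : ∀ {P W f} → SafeExcept P W f → k ≤ ncolours P f → Safe P W
  safeExcept⇒safe {P} {W} {f} record { reservation = R ; balanced = balanced } k≤c =
    record { reservation = R ; balanced = balanced′ }
    where
      balanced′ : ∀ g → Balanced P W g
      balanced′ g with g ≟ f
      ... | yes refl = +-mono-≤ (≤-trans k≤c (mult-mono {V = P} {W} (λ j → extends R j))) k≤c
      ... | no g≢f   = balanced g g≢f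

  reservation-assign : ∀ {P Q e i} → Reservation P Q → P i ∪ ⁅ e ⁆ ⊆ Q i → ncolours P e < k →
                       Reservation (assign P e i) Q
  reservation-assign {P} {Q} {e} {i} R P+e⊆Qi e<k = record
    { independent = independent R
    ; extends     = assign-⊆ P e i P+e⊆Qi (extends R)
    ; bounded     = bounded′
    }
    where
      bounded′ : ∀ g → ncolours (assign P e i) g ≤ k
      bounded′ g with g ≟ e
      ... | yes refl = ≤-trans (ncolours-assign-≤ P e i g) e<k
      ... | no g≢e   = ≤-trans (ncolours-assign-≢ P e i g≢e) (bounded R g)

  alice-move : ∀ {P W e} → SafeExcept P W e → ncolours P e < k →
               ∃ λ j → Admissible M k P e j × Safe (assign P e j) W
  alice-move {P} {W} {e} record { reservation = R ; balanced = balanced ; nearly = nearly } e<k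
    with mult<mult⇒∃ {V = P} {W} (k+k≤1+w+c∧c<k⇒c<w nearly e<k)
  ... | j , e∈Wj , e∉Pj =
    j , (e<k , e∉Pj , indep-⊆ (M j) P+e⊆Wj (independent R j)) ,
    record { reservation = reservation-assign R P+e⊆Wj e<k ; balanced = balanced′ }
    where
      P+e⊆Wj : P j ∪ ⁅ e ⁆ ⊆ W j
      P+e⊆Wj = ∪-least (extends R j) (x∈p⇒⁅x⁆⊆p e∈Wj)
      balanced′ : ∀ g → Balanced (assign P e j) W g
      balanced′ g with g ≟ e
      ... | yes refl = begin
        k + k                                ≤⟨ nearly ⟩
        suc (mult W e + ncolours P e)        ≡⟨ +-suc (mult W e) (ncolours P e) ⟨
        mult W e + suc (ncolours P e)        ≤⟨ +-monoʳ-≤ (mult W e) (ncolours-assign-> P e j e∉Pj) ⟩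
        mult W e + ncolours (assign P e j) e ∎
        where open ≤-Reasoning
      ... | no g≢e = ≤-trans (balanced g g≢e) (+-monoʳ-≤ (mult W g) (ncolours-assign-≥ P e j g))

  bob-move : ∀ {P W e i} → Safe P W → Admissible M k P e i →
             ∃₂ λ W′ f → SafeExcept (assign P e i) W′ f
  bob-move {P} {W} {e} {i} record { reservation = R ; balanced = balanced } (e<k , _ , iPi+e)
    with exchange (M i) (independent R i) (extends R i) iPi+e
  ... | A , iA , P+e⊆A , f , W-f⊆A = W′ , f , record
    { reservation = reservation-assign R′ P+e⊆W′i e<k
    ; balanced    = λ g g≢f → ≤-trans (balanced g) (+-mono-≤ (W≤W′ g≢f) (ncolours-assign-≥ P e i g))
    ; nearly      = ≤-trans (balanced f) (+-mono-≤ (W≤1+W′ f) (ncolours-assign-≥ P e i f))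
    }
    where
      W′ = updateAt W i (λ _ → A)
      R′ : Reservation P W′
      R′ = record
        { independent = updateAt-satisfies (λ j S → Indep (M j) S) W i (λ _ → A) iA (λ j _ → independent R j)
        ; extends     = updateAt-satisfies (λ j S → P j ⊆ S) W i (λ _ → A) (⊆-trans (p⊆p∪q _) P+e⊆A) (λ j _ → extends R j)
        ; bounded     = bounded R
        }
      P+e⊆W′i : P i ∪ ⁅ e ⁆ ⊆ W′ i
      P+e⊆W′i = subst (P i ∪ ⁅ e ⁆ ⊆_) (sym (updateAt-updates i W)) P+e⊆A
      W≤1+W′ : ∀ g → mult W g ≤ suc (mult W′ g)
      W≤1+W′ g = mult≤1+mult {V = W} {W′} i (λ j j≢i → subst (g ∈_) (sym (updateAt-minimal j i W j≢i)))
      W≤W′ : ∀ {g} → g ≢ f → mult W g ≤ mult W′ g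
      W≤W′ {g} g≢f = mult-mono {V = W} {W′} (updateAt-satisfies (λ j S → g ∈ W j → g ∈ S) W i (λ _ → A) (W-f⊆A g≢f) (λ _ _ g∈ → g∈))

  mutual
    alice : ∀ N {P W} → uncoloured P < N → Safe P W → AliceToMove M k P
    alice N {P} μ<N I with complete-or-deficient P k (bounded (Safe.reservation I))
    ... | inj₁ complete  = done complete
    ... | inj₂ (e , e<k) = alice-at N μ<N (safe⇒safeExcept I e) e<k

    alice-at : ∀ N {P W e} → uncoloured P < N → SafeExcept P W e → ncolours P e < k → AliceToMove M k P
    alice-at zero    () _ _
    alice-at (suc N) {P} {W} {e} μ<N I e<k with alice-move I e<k
    ... | j , admissible@(_ , e∉Pj , _) , I′ =
      play e j admissible (bob N (<-≤-trans (uncoloured-assign P e j e∉Pj) (≤-pred μ<N)) I′)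

    alice-repair : ∀ N {P W f} → uncoloured P < N → SafeExcept P W f → AliceToMove M k P
    alice-repair N {P} {f = f} μ<N I with ncolours P f <? k
    ... | yes f<k = alice-at N μ<N I f<k
    ... | no f≮k  = alice N μ<N (safeExcept⇒safe I (≮⇒≥ f≮k))

    bob : ∀ N {P W} → uncoloured P < N → Safe P W → BobToMove M k P
    bob zero    () _
    bob (suc N) {P} μ<N I with complete-or-deficient P k (bounded (Safe.reservation I))
    ... | inj₁ complete  = done complete
    ... | inj₂ (e , e<k) with alice-move (safe⇒safeExcept I e) e<k
    ... | j , admissible , _ = reply (e , j , admissible) λ e′ i admissible′@(_ , e′∉Pi , _) →
      let W′ , f , I′ = bob-move I admissible′
      in  alice-repair N (<-≤-trans (uncoloured-assign P e′ i e′∉Pi) (≤-pred μ<N)) I′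

double-covering⇒AliceWins : ∀ {n d} k (M : Fin d → Matroid n) (V : Fin d → Subset n) →
                            AllIndep M V → IsCovering (2 * k) V → AliceWins M k
double-covering⇒AliceWins {n} {d} k M V iV covering = alice (suc (uncoloured (start {n} {d}))) ≤-refl initial
  where
    open Strategy M k
    initial : Safe start V
    initial = record
      { reservation = record
        { independent = iV
        ; extends     = λ _ → ⊥⊆
        ; bounded     = λ g → subst (_≤ k) (sym (ncolours-start {d = d} g)) z≤n
        }
      ; balanced    = λ g → ≤-trans (≤-reflexive (sym (trans (covering g) (cong (k +_) (+-identityʳ k))))) (m≤m+n _ _)
      }

++-allIndep : ∀ {n d d′} (M : Matroid n) {V : Fin d → Subset n} {V′ : Fin d′ → Subset n} →
              AllIndep (λ _ → M) V → AllIndep (λ _ → M) V′ → AllIndep (λ _ → M) (V ++ V′)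
++-allIndep {d = d} M iV iV′ j with splitAt d j
... | inj₁ j₁ = iV j₁
... | inj₂ j₂ = iV′ j₂

++-isCovering : ∀ {n d d′ a b} {V : Fin d → Subset n} {V′ : Fin d′ → Subset n} →
                IsCovering a V → IsCovering b V′ → IsCovering (a + b) (V ++ V′)
++-isCovering {V = V} {V′} cV cV′ g = trans (mult-++ V V′ g) (cong₂ _+_ (cV g) (cV′ g))

covering⇒AliceWins-doubled : ∀ {n d} (M : Matroid n) a (V : Fin d → Subset n) →
                             AllIndep (λ _ → M) V → IsCovering a V → AliceWins {d = d + d} (λ _ → M) a
covering⇒AliceWins-doubled M a V iV cV = double-covering⇒AliceWins a (λ _ → M) (V ++ V) (++-allIndep M iV iV)
  (λ g → trans (++-isCovering {V = V} {V} cV cV g) (cong (a +_) (sym (+-identityʳ a))))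

-- (b + b) / a < 2b / a + p / q, with the denominators cleared.
[b+b]*[a*q]<[2*b*q+p*a]*a : ∀ a b p q → 1 ≤ a → 1 ≤ p → (b + b) * (a * q) < (2 * b * q + p * a) * a
[b+b]*[a*q]<[2*b*q+p*a]*a a b p q 1≤a 1≤p =
  subst ((b + b) * (a * q) <_) (sym expand) (m<m+n ((b + b) * (a * q)) (*-mono-≤ (*-mono-≤ 1≤p 1≤a) 1≤a))
  where
    open +-*-Solver
    expand : (2 * b * q + p * a) * a ≡ (b + b) * (a * q) + p * a * a
    expand = solve 4 (λ a b p q → (con 2 :* b :* q :+ p :* a) :* a := (b :+ b) :* (a :* q) :+ p :* a :* a) refl a b p q

theorem1 :
    (∀ (n d k : ℕ) → 1 ≤ k → (M : Fin d → Matroid n) → (V : Fin d → Subset n) →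
      AllIndep M V → IsCovering (2 * k) V → AliceWins M k)
    ×
    (∀ (n : ℕ) (M : Matroid n) → Loopless M →
      ∀ (d : ℕ) (V : Fin d → Subset n) → AllIndep (λ _ → M) V → IsCovering 1 V →
      Σ ℕ λ d′ → d′ ≤ 2 * d × AliceWins {n} {d′} (λ _ → M) 1)
    ×
    (∀ (n : ℕ) (M : Matroid n) → Loopless M →
      ∀ (a b : ℕ) → 1 ≤ a → (V : Fin b → Subset n) → AllIndep (λ _ → M) V → IsCovering a V →
      ∀ (p q : ℕ) → 1 ≤ p → 1 ≤ q →
      Σ ℕ λ a′ → Σ ℕ λ b′ → 1 ≤ a′ × AliceWins {n} {b′} (λ _ → M) a′ ×
        b′ * (a * q) < (2 * b * q + p * a) * a′)
-- Looplessness is only what makes a covering by independent sets exist; one is given here.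
theorem1 =
  (λ n d k _ → double-covering⇒AliceWins k) ,
  (λ n M _ d V iV cV →
    d + d , ≤-reflexive (cong (d +_) (sym (+-identityʳ d))) , covering⇒AliceWins-doubled M 1 V iV cV) ,
  (λ n M _ a b 1≤a V iV cV p q 1≤p _ →
    a , b + b , 1≤a , covering⇒AliceWins-doubled M a V iV cV , [b+b]*[a*q]<[2*b*q+p*a]*a a b p q 1≤a 1≤p)
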